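{- Let $\mathcal M,\mathcal N$ be Kripke models with transitive relations. Then: (a) the frame of $\hat{\mathcal M}$ is a TC frame; (b) if $w$ is a point of $\mathcal M$ and $v$ a point of $\mathcal N$ such that $(\mathcal M,w)$ and $(\mathcal N,v)$ are locally bisimilar, then $(\hat{\mathcal M},w)$ and $(\hat{\mathcal N},v)$ are locally bisimilar; (c) $(\hat{\mathcal M},\infty)$ and $(\hat{\mathcal N},\infty)$ are locally bisimilar.
   Context: For a Kripke model $\mathcal K=(W,R,V)$, $\hat{\mathcal K}$ is the model with domain $W\cup\{\infty\}$ ($\infty\notin W$ a new point), relation $R\cup((W\cup\{\infty\})\times\{\infty\})$ (every point, including $\infty$, sees $\infty$), and valuation extending $V$ with no variable true at $\infty$. A TC frame is a Kripke frame with relation transitive and serial (every point has a successor) which is connected (any two points $w,v$ are joined by a sequence $w=b_0,\dots,b_k=v$ with $b_tRb_{t+1}$ or $b_{t+1}Rb_t$ for each $t$) and locally connected (for each point $a$, any two points of $R(a)=\{x:aRx\}$ are joined by such a sequence lying inside $R(a)$). Two pointed models are locally bisimilar if there is a standard Kripke bisimulation between the models relating the two points. -}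

module Defs where

open import Data.Nat using (ℕ)
open import Data.Maybe using (Maybe; just; nothing)
open import Data.Product using (Σ; ∃; _×_; _,_)
open import Data.Sum using (_⊎_)
open import Data.Empty using (⊥)
open import Data.Unit using (⊤)
open import Function.Bundles using (_⇔_)

Var : Set
Var = ℕ

record Frame : Set₁ where
  field
    W : Set
    R : W → W → Set

record Model : Set₁ where
  field
    W : Set
    R : W → W → Set
    V : Var → W → Set

frameOf : Model → Frame
frameOf M = record { W = Model.W M ; R = Model.R M }

Transitive : {A : Set} → (A → A → Set) → Set
Transitive {A} R = ∀ {x y z : A} → R x y → R y z → R x z

Serial : {A : Set} → (A → A → Set) → Set
Serial {A} R = ∀ (x : A) → ∃ λ y → R x y

data ZigZag {A : Set} (R : A → A → Set) (P : A → Set) : A → A → Set where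
  here : ∀ {w} → P w → ZigZag R P w w
  step : ∀ {w u v} → P w → (R w u ⊎ R u w) → ZigZag R P u v → ZigZag R P w v

Everywhere : {A : Set} → A → Set
Everywhere _ = ⊤

Connected : {A : Set} → (A → A → Set) → Set
Connected {A} R = ∀ (w v : A) → ZigZag R Everywhere w v

LocallyConnected : {A : Set} → (A → A → Set) → Set
LocallyConnected {A} R =
  ∀ (a w v : A) → R a w → R a v → ZigZag R (R a) w v

record IsTC (F : Frame) : Set where
  open Frame F
  field
    trans  : Transitive R
    serial : Serial R
    conn   : Connected R
    lconn  : LocallyConnected R

-- The model 𝓚̂ : domain W ∪ {∞} (∞ = nothing), every point sees ∞,
-- no variable true at ∞.
hatR : {A : Set} → (A → A → Set) → Maybe A → Maybe A → Set
hatR R (just x) (just y) = R x y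
hatR R _        nothing  = ⊤
hatR R nothing  (just _) = ⊥

hatV : {A : Set} → (Var → A → Set) → Var → Maybe A → Set
hatV V p (just x) = V p x
hatV V p nothing  = ⊥

hat : Model → Model
hat M = record
  { W = Maybe (Model.W M)
  ; R = hatR (Model.R M)
  ; V = hatV (Model.V M)
  }

∞ : {A : Set} → Maybe A
∞ = nothing

record IsBisimulation (M N : Model) (Z : Model.W M → Model.W N → Set) : Set where
  private
    module M = Model M
    module N = Model N
  field
    atoms : ∀ {w v} → Z w v → ∀ (p : Var) → (M.V p w ⇔ N.V p v)
    forth : ∀ {w v w'} → Z w v → M.R w w' → ∃ λ v' → N.R v v' × Z w' v'
    back  : ∀ {w v v'} → Z w v → N.R v v' → ∃ λ w' → M.R w w' × Z w' v'

LocallyBisimilar : (M : Model) → Model.W M → (N : Model) → Model.W N → Set₁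
LocallyBisimilar M w N v =
  Σ (Model.W M → Model.W N → Set) λ Z → IsBisimulation M N Z × Z w v

module Submission where

-- The frame part rests on one observation about relations: a point that is
-- seen by every point (a "universal sink") makes the relation serial, and
-- joins any two points w, v by the zig-zag  w → ∞ ← v ; inside R(a) the same
-- path works because ∞ ∈ R(a).  Transitivity of the hatted relation is a
-- finite case analysis, using that ∞ sees no point of the original model.
--
-- For bisimilarity, a relation Z between the models lifts to Ẑ, which is Z
-- on old points and additionally relates ∞ to ∞; if Z is a bisimulation then
-- so is Ẑ, since every ∞-step is matched by an ∞-step and ∞ satisfies no
-- variable on either side.  Part (b) lifts the given bisimulation, part (c)
-- lifts the empty one.

open import Defs
open import Data.Product using (Σ; _×_; _,_)
open import Data.Maybe using (Maybe; just; nothing)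
open import Data.Sum using (inj₁; inj₂)
open import Data.Empty using (⊥; ⊥-elim)
open import Data.Unit using (⊤; tt)
open import Function.Bundles using (_⇔_; mk⇔)

module UniversalSink {A : Set} (R : A → A → Set) (s : A) (sees : ∀ x → R x s) where

  serial : Serial R
  serial x = s , sees x

  viaSink : (P : A → Set) → ∀ {w v} → P w → P s → P v → ZigZag R P w v
  viaSink P pw ps pv = step pw (inj₁ (sees _)) (step ps (inj₂ (sees _)) (here pv))

  connected : Connected R
  connected w v = viaSink Everywhere tt tt tt

  -- R(a) contains the sink, so the same path stays inside R(a).
  locallyConnected : LocallyConnected R
  locallyConnected a w v aw av = viaSink (R a) aw (sees a) av

hatR-∞ : {A : Set} (R : A → A → Set) (x : Maybe A) → hatR R x ∞
hatR-∞ R (just _) = tt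
hatR-∞ R nothing  = tt

-- Hatting preserves transitivity; ∞ is a dead end apart from its loop.
hatR-trans : {A : Set} {R : A → A → Set} → Transitive R → Transitive (hatR R)
hatR-trans t {just _}  {just _}  {just _}  xy yz = t xy yz
hatR-trans t {just _}  {nothing} {just _}  _  ∞z = ⊥-elim ∞z
hatR-trans t {nothing} {just _}  {just _}  ∞y _  = ∞y
hatR-trans t {nothing} {nothing} {just _}  _  ∞z = ∞z
hatR-trans t {just _}  {_}       {nothing} _  _  = tt
hatR-trans t {nothing} {_}       {nothing} _  _  = tt

hat-isTC : (M : Model) → Transitive (Model.R M) → IsTC (frameOf (hat M))
hat-isTC M t = record
  { trans  = λ {x} {y} {z} → hatR-trans t {x} {y} {z}
  ; serial = serial
  ; conn   = connected
  ; lconn  = locallyConnected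
  }
  where open UniversalSink (hatR (Model.R M)) ∞ (hatR-∞ (Model.R M))

hatZ : {A B : Set} → (A → B → Set) → Maybe A → Maybe B → Set
hatZ Z (just x) (just y) = Z x y
hatZ Z nothing  nothing  = ⊤
hatZ Z _        _        = ⊥

module _ {M N : Model} where
  private
    module M = Model M
    module N = Model N

  hat-bisimulation : {Z : M.W → N.W → Set} →
    IsBisimulation M N Z → IsBisimulation (hat M) (hat N) (hatZ Z)
  hat-bisimulation {Z} B = record
    { atoms = λ {w} {v} → atoms {w} {v}
    ; forth = λ {w} {v} {w'} → forth {w} {v} {w'}
    ; back  = λ {w} {v} {v'} → back {w} {v} {v'}
    }
    where
    module B = IsBisimulation B

    -- ∞ satisfies no variable in either model.
    atoms : ∀ {w v} → hatZ Z w v → ∀ p → (hatV M.V p w ⇔ hatV N.V p v)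
    atoms {just _}  {just _}  z p = B.atoms z p
    atoms {nothing} {nothing} _ p = mk⇔ (λ ()) (λ ())

    forth : ∀ {w v w'} → hatZ Z w v → hatR M.R w w' →
            Σ (Maybe N.W) λ v' → hatR N.R v v' × hatZ Z w' v'
    forth {just _} {just _} {just _} z r with B.forth z r
    ... | v' , r' , z' = just v' , r' , z'
    forth {just _}  {just _}  {nothing} _ _ = ∞ , tt , tt
    forth {nothing} {nothing} {nothing} _ _ = ∞ , tt , tt

    back : ∀ {w v v'} → hatZ Z w v → hatR N.R v v' →
           Σ (Maybe M.W) λ w' → hatR M.R w w' × hatZ Z w' v'
    back {just _} {just _} {just _} z r with B.back z r
    ... | w' , r' , z' = just w' , r' , z'
    back {just _}  {just _}  {nothing} _ _ = ∞ , tt , tt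
    back {nothing} {nothing} {nothing} _ _ = ∞ , tt , tt

  hat-locallyBisimilar : ∀ {w v} →
    LocallyBisimilar M w N v → LocallyBisimilar (hat M) (just w) (hat N) (just v)
  hat-locallyBisimilar (Z , B , z) = hatZ Z , hat-bisimulation B , z

  empty-bisimulation : IsBisimulation M N (λ _ _ → ⊥)
  empty-bisimulation = record { atoms = λ () ; forth = λ () ; back = λ () }

  ∞-locallyBisimilar : LocallyBisimilar (hat M) ∞ (hat N) ∞
  ∞-locallyBisimilar = hatZ (λ _ _ → ⊥) , hat-bisimulation empty-bisimulation , tt

lemma7p20 : (M N : Model) → Transitive (Model.R M) → Transitive (Model.R N) →
    IsTC (frameOf (hat M))
    × (∀ (w : Model.W M) (v : Model.W N) → LocallyBisimilar M w N v →
         LocallyBisimilar (hat M) (just w) (hat N) (just v))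
    × LocallyBisimilar (hat M) ∞ (hat N) ∞
lemma7p20 M N transM _ =
  hat-isTC M transM , (λ _ _ → hat-locallyBisimilar) , ∞-locallyBisimilar
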